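{- Let $\mathbb P=(P,(P_p)_{p\in P},(\vdash^p)_{p\in P})$ be a stratified conjunctive logic. Then the rule (INT) — for all $p\in P$, $\Gamma\in\mathcal P_f(\mathcal L(P_p))\cup\{\{p\}\}$ and $\varphi\in\mathcal L(P_p)$: if $\Gamma\vdash^p\varphi$ then there are $r\in P_p$ and $\xi\in\mathcal L(P_r)$ with $\Gamma\vdash^p r\wedge\xi$ and $\xi\vdash^r\varphi$ — holds if and only if the rule (SINT) holds: for all $p\in P$, $\Gamma\in\mathcal P_f(\mathcal L(P_p))\cup\{\{p\}\}$ and $\varphi\in\mathcal L(P_p)$: if $\Gamma\vdash^p\varphi$ then there is $r\in P_p$ with $\Gamma\vdash^p r$ and $r\vdash^r\varphi$.
   Context: Let $P$ be a set of atomic propositions containing a constant $\top$ ("true"). For $Q\subseteq P$, $\mathcal L(Q)$ is the set of formulae built from the elements of $Q$ by the binary connective $\wedge$. For a nonempty finite set $\Gamma=\{\varphi_1,\dots,\varphi_n\}$ of formulae, $\bigwedge\Gamma=\varphi_1\wedge\dots\wedge\varphi_n$ (bracketed to the left), and $\bigwedge\emptyset=\top$. $\mathcal P_f(M)$ denotes the set of finite subsets of $M$. In sequents the left side is a finite set; "$\Delta,\varphi$" means $\Delta\cup\{\varphi\}$ and a single formula $\varphi$ stands for $\{\varphi\}$. A stratified conjunctive logic $\mathbb P=(P,(P_p)_{p\in P},(\vdash^p)_{p\in P})$ consists of such $P$, subsets $P_p\subseteq P$ and relations $\vdash^p\subseteq(\mathcal P_f(\mathcal L(P_p))\cup\{\{p\}\})\times\mathcal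 L(P_p)$ such that for all $p,q\in P$, $\Gamma\in\mathcal P_f(\mathcal L(P_p))\cup\{\{p\}\}$, $\Delta\in\mathcal P_f(\mathcal L(P_p))$ and $\varphi,\psi,\theta,\xi\in\mathcal L(P_p)$: (1) if $q\in P_p$ then $p\vdash^pq$; (2) if $q\vdash^qp$ then $P_p\subseteq P_q$; (3) if $q\vdash^qp$ and $\Gamma\vdash^p\theta$ then $\Gamma\vdash^q\theta$; (4) $\vdash^p$ is closed under: (R$\top$) $\Gamma\vdash^p\top$; (L$\wedge$) $\Delta,\varphi,\psi\vdash^p\theta$ iff $\Delta,\varphi\wedge\psi\vdash^p\theta$; (R$\wedge$) ($\Gamma\vdash^p\varphi$ and $\Gamma\vdash^p\psi$) iff $\Gamma\vdash^p\varphi\wedge\psi$; (Cut) $\Gamma\vdash^p\varphi$ and $\varphi\vdash^p\psi$ imply $\Gamma\vdash^p\psi$; (W) $\Delta\vdash^p\varphi$ implies $\Delta,\xi\vdash^p\varphi$. -}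

module Defs where

open import Data.List using (List; []; _∷_; [_])
open import Data.List.Membership.Propositional using (_∈_)
open import Data.List.Relation.Unary.All using (All)
open import Data.Product using (Σ; _×_; _,_)
open import Data.Sum using (_⊎_)
open import Function.Bundles using (_⇔_)

data Form (A : Set) : Set where
  atom : A → Form A
  _∧_  : Form A → Form A → Form A

infixl 6 _∧_

-- φ ∈ 𝓛(Q), for Q ⊆ A given as a predicate.
data InL {A : Set} (Q : A → Set) : Form A → Set where
  atomL : ∀ {a} → Q a → InL Q (atom a)
  andL  : ∀ {φ ψ} → InL Q φ → InL Q ψ → InL Q (φ ∧ ψ)

-- Finite sets of formulae are represented by lists, considered up to
-- having the same elements.
SetEq : {A : Set} → List A → List A → Set
SetEq Γ Δ = (∀ {x} → x ∈ Γ → x ∈ Δ) × (∀ {x} → x ∈ Δ → x ∈ Γ)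

record StratConjLogic (P : Set) (⊤ : P) : Set₁ where
  field
    -- Sub p q  means  q ∈ P_p
    Sub : P → P → Set
    -- Seq p Γ φ  means  Γ ⊢^p φ
    Seq : P → List (Form P) → Form P → Set

  Adm : P → List (Form P) → Set
  Adm p Γ = All (InL (Sub p)) Γ ⊎ SetEq Γ [ atom p ]

  field
    -- sequents are between finite sets (invariance under set equality)
    seq-set : ∀ {p Γ Δ φ} → SetEq Γ Δ → Seq p Γ φ → Seq p Δ φ
    seq-dom : ∀ {p Γ φ} → Seq p Γ φ → Adm p Γ × InL (Sub p) φ
    ax1 : ∀ p q → Sub p q → Seq p [ atom p ] (atom q)
    ax2 : ∀ p q → Seq q [ atom q ] (atom p) → ∀ r → Sub p r → Sub q r
    ax3 : ∀ p q Γ θ → Adm p Γ → InL (Sub p) θ →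
          Seq q [ atom q ] (atom p) → Seq p Γ θ → Seq q Γ θ
    rTop : ∀ p Γ → Adm p Γ → Seq p Γ (atom ⊤)
    lAnd : ∀ p Δ φ ψ θ → All (InL (Sub p)) Δ → InL (Sub p) φ → InL (Sub p) ψ →
           InL (Sub p) θ → Seq p (φ ∷ ψ ∷ Δ) θ ⇔ Seq p ((φ ∧ ψ) ∷ Δ) θ
    rAnd : ∀ p Γ φ ψ → Adm p Γ → InL (Sub p) φ → InL (Sub p) ψ →
           (Seq p Γ φ × Seq p Γ ψ) ⇔ Seq p Γ (φ ∧ ψ)
    cut : ∀ p Γ φ ψ → Adm p Γ → InL (Sub p) φ → InL (Sub p) ψ →
          Seq p Γ φ → Seq p [ φ ] ψ → Seq p Γ ψ
    weak : ∀ p Δ φ ξ → All (InL (Sub p)) Δ → InL (Sub p) φ → InL (Sub p) ξ →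
           Seq p Δ φ → Seq p (ξ ∷ Δ) φ

module _ {P : Set} {⊤ : P} (𝕃 : StratConjLogic P ⊤) where
  open StratConjLogic 𝕃

  INT : Set
  INT = ∀ p Γ φ → Adm p Γ → InL (Sub p) φ → Seq p Γ φ →
        Σ P λ r → Sub p r × Σ (Form P) λ ξ → InL (Sub r) ξ ×
          Seq p Γ (atom r ∧ ξ) × Seq r [ ξ ] φ

  SINT : Set
  SINT = ∀ p Γ φ → Adm p Γ → InL (Sub p) φ → Seq p Γ φ →
         Σ P λ r → Sub p r × Seq p Γ (atom r) × Seq r [ atom r ] φ

{-# OPTIONS --safe #-}
module Submission where

-- From (INT) to (SINT): ξ ∈ 𝓛(P_r) gives r ⊢^r ξ by (1) and R∧, so a cut
-- turns ξ ⊢^r φ into r ⊢^r φ, and R∧ drops ξ from Γ ⊢^p r ∧ ξ.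
-- From (SINT) to (INT): the atom r need not lie in P_r, so ξ = r is not
-- available; instead apply (SINT) once more, to r ⊢^r φ, obtaining r' ∈ P_r,
-- and take ξ = r'. Axiom (3) along p ⊢^p r and r ⊢^r r' moves the sequents
-- r ⊢^r r' and r' ⊢^r' φ into the strata p and r.

open import Function.Base using (id)
open import Function.Bundles using (_⇔_; mk⇔; Equivalence)
open import Data.List using (List; [_])
open import Data.Product using (_,_; proj₁; proj₂)
open import Data.Sum using (inj₂)

open import Defs

module Derived {P : Set} {⊤ : P} (𝕃 : StratConjLogic P ⊤) where
  open StratConjLogic 𝕃

  private variable
    p q : P
    Γ : List (Form P)
    φ ψ θ : Form P

  Adm-self : ∀ p → Adm p [ atom p ]
  Adm-self p = inj₂ (id , id)

  InL-∧ˡ : ∀ {Q : P → Set} → InL Q (φ ∧ ψ) → InL Q φ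
  InL-∧ˡ (andL φL _) = φL

  InL-∧ʳ : ∀ {Q : P → Set} → InL Q (φ ∧ ψ) → InL Q ψ
  InL-∧ʳ (andL _ ψL) = ψL

  ∧-intro : Seq p Γ φ → Seq p Γ ψ → Seq p Γ (φ ∧ ψ)
  ∧-intro {p} {Γ} {φ} {ψ} d e =
    Equivalence.to (rAnd p Γ φ ψ (proj₁ (seq-dom d)) (proj₂ (seq-dom d)) (proj₂ (seq-dom e)))
      (d , e)

  ∧-elimˡ : Seq p Γ (φ ∧ ψ) → Seq p Γ φ
  ∧-elimˡ {p} {Γ} {φ} {ψ} d =
    proj₁ (Equivalence.from (rAnd p Γ φ ψ (proj₁ (seq-dom d)) (InL-∧ˡ φψL) (InL-∧ʳ φψL)) d)
    where
    φψL : InL (Sub p) (φ ∧ ψ)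
    φψL = proj₂ (seq-dom d)

  cut′ : Seq p Γ φ → Seq p [ φ ] ψ → Seq p Γ ψ
  cut′ {p} {Γ} {φ} {ψ} d e =
    cut p Γ φ ψ (proj₁ (seq-dom d)) (proj₂ (seq-dom d)) (proj₂ (seq-dom e)) d e

  transfer : Seq q [ atom q ] (atom p) → Seq p Γ θ → Seq q Γ θ
  transfer {q} {p} {Γ} {θ} q⊢p d =
    ax3 p q Γ θ (proj₁ (seq-dom d)) (proj₂ (seq-dom d)) q⊢p d

  atom-⊢ : InL (Sub p) φ → Seq p [ atom p ] φ
  atom-⊢ {p} (atomL pq) = ax1 p _ pq
  atom-⊢ (andL φL ψL) = ∧-intro (atom-⊢ φL) (atom-⊢ ψL)

  INT⇒SINT : INT 𝕃 → SINT 𝕃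
  INT⇒SINT int p Γ φ Γ-adm φL Γ⊢φ
    with r , pr , ξ , ξL , Γ⊢r∧ξ , ξ⊢φ ← int p Γ φ Γ-adm φL Γ⊢φ =
    r , pr , ∧-elimˡ Γ⊢r∧ξ , cut′ (atom-⊢ ξL) ξ⊢φ

  SINT⇒INT : SINT 𝕃 → INT 𝕃
  SINT⇒INT sint p Γ φ Γ-adm φL Γ⊢φ
    with r , pr , Γ⊢r , r⊢φ ← sint p Γ φ Γ-adm φL Γ⊢φ
    with r′ , rr′ , r⊢r′ , r′⊢φ ← sint r [ atom r ] φ (Adm-self r) (proj₂ (seq-dom r⊢φ)) r⊢φ =
    r , pr , atom r′ , atomL rr′ ,
    ∧-intro Γ⊢r (cut′ Γ⊢r (transfer (ax1 p r pr) r⊢r′)) ,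
    transfer r⊢r′ r′⊢φ

lemma7p6 : (P : Set) (⊤ : P) (𝕃 : StratConjLogic P ⊤) → INT 𝕃 ⇔ SINT 𝕃
lemma7p6 P ⊤ 𝕃 = mk⇔ INT⇒SINT SINT⇒INT
  where open Derived 𝕃
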